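{- Let $G$ be a nontrivial connected graph. Then $\mathrm{srd}(G)=1$ if and only if $\mathrm{rd}(G)=1$.
   Context: All graphs are simple, finite and undirected. An edge-coloring of $G$ is any map $c:E(G)\to[k]$ (adjacent edges may receive the same color). For distinct vertices $u,v$ of a connected graph $G$, a $u$-$v$-edge-cut is a set $F$ of edges such that $u$ and $v$ lie in different components of $G-F$; a minimum $u$-$v$-edge-cut is one of minimum size among these. A set of edges is rainbow if no two of its edges have the same color. An edge-colored connected graph is rainbow disconnected if for every two distinct vertices $u,v$ there is a rainbow $u$-$v$-edge-cut; $\mathrm{rd}(G)$ is the smallest number of colors of an edge-coloring making $G$ rainbow disconnected. An edge-colored connected graph is strong rainbow disconnected if for every two distinct vertices $u,v$ there is a $u$-$v$-edge-cut that is both rainbow and minimum; $\mathrm{srd}(G)$ is the smallest number of colors of an edge-coloring making $G$ strong rainbow disconnected. -}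

module Defs where

open import Data.Nat using (ℕ; _<_; _≤_)
open import Data.Fin using (Fin; toℕ)
open import Data.Bool using (Bool; true)
open import Data.Product using (Σ; ∃; _×_; _,_)
open import Data.Sum using (_⊎_)
open import Data.List using (List; length)
open import Data.List.Membership.Propositional using (_∈_)
open import Data.List.Relation.Unary.All using (All)
open import Data.List.Relation.Unary.AllPairs using (AllPairs)
open import Data.List.Relation.Unary.Unique.Propositional using (Unique)
open import Relation.Binary.PropositionalEquality using (_≡_; _≢_)
open import Relation.Nullary using (¬_)

record Graph (n : ℕ) : Set where
  field
    adj     : Fin n → Fin n → Bool
    adj-sym : ∀ u v → adj u v ≡ adj v u
    adj-irr : ∀ u → ¬ (adj u u ≡ true)
open Graph public

module _ {n : ℕ} (G : Graph n) where

  -- An edge {u,v} is represented canonically by the ordered pair (u , v) with u < v.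
  IsEdge : Fin n × Fin n → Set
  IsEdge (u , v) = (toℕ u < toℕ v) × (adj G u v ≡ true)

  EdgeSet : List (Fin n × Fin n) → Set
  EdgeSet F = All IsEdge F × Unique F

  InF : List (Fin n × Fin n) → Fin n → Fin n → Set
  InF F a b = ((a , b) ∈ F) ⊎ ((b , a) ∈ F)

  data Reach (F : List (Fin n × Fin n)) (u : Fin n) : Fin n → Set where
    here : Reach F u u
    step : ∀ {w x} → Reach F u w → adj G w x ≡ true → ¬ InF F w x → Reach F u x

  Connected : Set
  Connected = ∀ u v → Reach [] u v
    where open import Data.List using ([])

  IsCut : Fin n → Fin n → List (Fin n × Fin n) → Set
  IsCut u v F = EdgeSet F × ¬ Reach F u v

  IsMinCut : Fin n → Fin n → List (Fin n × Fin n) → Set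
  IsMinCut u v F = IsCut u v F × (∀ F′ → IsCut u v F′ → length F ≤ length F′)

  -- an edge-coloring with colors in [k] (values on non-edges are irrelevant)
  Coloring : ℕ → Set
  Coloring k = Fin n → Fin n → Fin k

  Rainbow : ∀ {k} → Coloring k → List (Fin n × Fin n) → Set
  Rainbow c F = AllPairs (λ e f → col e ≢ col f) F
    where
    col : Fin n × Fin n → _
    col (a , b) = c a b

  RainbowDisconnected : ∀ {k} → Coloring k → Set
  RainbowDisconnected c =
    ∀ u v → u ≢ v → Σ (List (Fin n × Fin n)) λ F → IsCut u v F × Rainbow c F

  StrongRainbowDisconnected : ∀ {k} → Coloring k → Set
  StrongRainbowDisconnected c =
    ∀ u v → u ≢ v → Σ (List (Fin n × Fin n)) λ F → IsMinCut u v F × Rainbow c F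

  RdIs : ℕ → Set
  RdIs k = (Σ (Coloring k) RainbowDisconnected)
         × (∀ j → j < k → ¬ Σ (Coloring j) RainbowDisconnected)

  SrdIs : ℕ → Set
  SrdIs k = (Σ (Coloring k) StrongRainbowDisconnected)
          × (∀ j → j < k → ¬ Σ (Coloring j) StrongRainbowDisconnected)

{-# OPTIONS --safe #-}
module Submission where

-- With a single colour a rainbow edge set has at most one edge, while in a
-- connected graph every u-v-edge-cut has at least one. So every rainbow cut is
-- a minimum cut, and a 1-colouring is rainbow disconnected exactly when it is
-- strong rainbow disconnected. Zero colours are impossible on a nonempty graph,
-- so in both cases 1 is the least number of colours.

open import Defs
open import Data.Nat using (ℕ; suc; _≤_; _<_; z≤n; s≤s)
open import Data.Nat.Properties using (≤-trans)
open import Function.Bundles using (_⇔_; mk⇔)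
open import Data.Fin using (Fin; zero)
open import Data.Fin.Properties using (¬Fin0)
open import Data.List using (List; []; _∷_; length)
open import Data.List.Relation.Unary.All using (_∷_)
open import Data.List.Relation.Unary.AllPairs using (_∷_)
open import Data.Product using (Σ; _×_; _,_)
open import Relation.Binary.PropositionalEquality using (_≡_; refl)
open import Relation.Nullary using (¬_; contradiction)

Fin1-unique : (i j : Fin 1) → i ≡ j
Fin1-unique zero zero = refl

module _ {n : ℕ} (G : Graph n) where

  Rainbow-1⇒length≤1 : (c : Coloring G 1) {F : List (Fin n × Fin n)} →
                       Rainbow G c F → length F ≤ 1
  Rainbow-1⇒length≤1 c {[]}                      _                = z≤n
  Rainbow-1⇒length≤1 c {_ ∷ []}                  _                = s≤s z≤n
  Rainbow-1⇒length≤1 c {(a , b) ∷ (a′ , b′) ∷ _} ((c≢c′ ∷ _) ∷ _) =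
    contradiction (Fin1-unique (c a b) (c a′ b′)) c≢c′

  Connected⇒cut-nonempty : Connected G → ∀ {u v F} → IsCut G u v F → 1 ≤ length F
  Connected⇒cut-nonempty con {u} {v} {[]} (_ , ¬reach) = contradiction (con u v) ¬reach
  Connected⇒cut-nonempty con {F = _ ∷ _} _        = s≤s z≤n

  Rainbow-1-cut⇒min-cut : Connected G → (c : Coloring G 1) → ∀ {u v F} →
                          IsCut G u v F → Rainbow G c F → IsMinCut G u v F
  Rainbow-1-cut⇒min-cut con c cut rainbow =
    cut , λ F′ cut′ → ≤-trans (Rainbow-1⇒length≤1 c rainbow)
                              (Connected⇒cut-nonempty con cut′)

  StrongRainbowDisconnected⇒RainbowDisconnected :
    ∀ {k} {c : Coloring G k} → StrongRainbowDisconnected G c → RainbowDisconnected G c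
  StrongRainbowDisconnected⇒RainbowDisconnected srd u v u≢v
    with srd u v u≢v
  ... | F , (cut , _) , rainbow = F , cut , rainbow

  RainbowDisconnected-1⇒StrongRainbowDisconnected :
    Connected G → {c : Coloring G 1} → RainbowDisconnected G c → StrongRainbowDisconnected G c
  RainbowDisconnected-1⇒StrongRainbowDisconnected con {c} rd u v u≢v
    with rd u v u≢v
  ... | F , cut , rainbow = F , Rainbow-1-cut⇒min-cut con c cut rainbow , rainbow

module _ {n : ℕ} (G : Graph (suc n)) where

  ¬Coloring-0 : ¬ Coloring G 0
  ¬Coloring-0 c = ¬Fin0 (c zero zero)

  no-Coloring-below-1 : (P : ∀ {k} → Coloring G k → Set) → ∀ j → j < 1 → ¬ Σ (Coloring G j) P
  no-Coloring-below-1 P 0 (s≤s z≤n) (c , _) = ¬Coloring-0 c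

theorem2p8 : ∀ (n : ℕ) (G : Graph n) → 2 ≤ n → Connected G → (SrdIs G 1 ⇔ RdIs G 1)
theorem2p8 (suc n) G (s≤s _) con = mk⇔ srd⇒rd rd⇒srd
  where
  srd⇒rd : SrdIs G 1 → RdIs G 1
  srd⇒rd ((c , srd) , _) =
    (c , StrongRainbowDisconnected⇒RainbowDisconnected G srd)
    , no-Coloring-below-1 G (RainbowDisconnected G)

  rd⇒srd : RdIs G 1 → SrdIs G 1
  rd⇒srd ((c , rd) , _) =
    (c , RainbowDisconnected-1⇒StrongRainbowDisconnected G con rd)
    , no-Coloring-below-1 G (StrongRainbowDisconnected G)
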